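{- Let $n\geq 0$ and $0<k<F_{n+2}$. Write $k-1=\sum_{i=2}^{n+1}u_iF_i$ and $k=\sum_{i=2}^{n+1}v_iF_i$ as Zeckendorf-Fibonacci expansions (padded with leading zeros to indices $2,\dots,n+1$), and let $j$ be the largest index with $u_j\neq v_j$. Then the $k$-th move of the unique optimal (minimal-length) solution of the Tower of Hanoi-Fibonacci with $n$ disks, going from $(\Delta_n,\varnothing,\varnothing)$ to $(\varnothing,\varnothing,\Delta_n)$, is a $(j-1)$-Fibonacci move.
   Context: Fibonacci numbers: $F_1=F_2=1$, $F_{m+2}=F_{m+1}+F_m$. Zeckendorf-Fibonacci expansion: every integer $m\geq 0$ is uniquely $\sum_{i\geq 2}u_iF_i$ with $u_i\in\{0,1\}$, finitely many nonzero, and $u_iu_{i+1}=0$ for all $i$. Disks $1,\dots,n$, $\Delta_k=\{1,\dots,k\}$ ($\varnothing$ for $k<1$). A state is an ordered triple $(A,B,C)$ of disjoint sets with union $\Delta_n$ (each peg stacked in decreasing order, top = minimum). For $k\in\Delta_n$, a $k$-Fibonacci move is defined when two distinct pegs $X,Y$ satisfy $X=k\tilde X$, $Y=\Delta_{k-1}\tilde Y$ (all disks of $\tilde X,\tilde Y$ larger than $k$) and the third peg $Z$ contains only disks larger than $k$; it yields $\tilde{X}\sqcup \Delta_{k-2}\tilde{Y}\sqcup (k-1)kZ$ (disks $k-1,k$ put simultaneously onto $Z$; peg positions preserved). The Tower of Hanoi-Fibonacci allows only such moves; its optimal solution from $(\Delta_n,\varnothing,\varnothing)$ to $(\varnothing,\varnothing,\Delta_n)$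 is unique and has $F_{n+2}-1$ moves. -}

module Defs where

open import Data.Nat using (ℕ; zero; suc; _+_; _*_; _∸_; _≤_; _<_)
open import Data.Bool using (Bool; true; false; if_then_else_)
open import Data.Fin using (Fin; toℕ) renaming (zero to fz; suc to fs)
open import Data.Product using (Σ; _×_; ∃; _,_)
open import Data.Sum using (_⊎_)
open import Relation.Binary.PropositionalEquality using (_≡_; _≢_)

fib : ℕ → ℕ
fib zero = 0
fib (suc zero) = 1
fib (suc (suc m)) = fib (suc m) + fib m

fibSum : (ℕ → Bool) → ℕ → ℕ
fibSum u zero = if u zero then fib zero else 0
fibSum u (suc N) = fibSum u N + (if u (suc N) then fib (suc N) else 0)

IsZeckendorf : ℕ → ℕ → (ℕ → Bool) → Set
IsZeckendorf n m u =
  (∀ i → u i ≡ true → 2 ≤ i × i ≤ suc n) ×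
  (∀ i → u i ≡ true → u (suc i) ≡ false) ×
  (m ≡ fibSum u (suc n))

Peg : Set
Peg = Fin 3

pegA pegC : Peg
pegA = fz
pegC = fs (fs fz)

-- A state assigns each disk to a peg; disk i : Fin n is the disk
-- numbered suc (toℕ i) ∈ {1,…,n}.  (Stacking order on a peg is forced.)
State : ℕ → Set
State n = Fin n → Peg

disk : {n : ℕ} → Fin n → ℕ
disk i = suc (toℕ i)

-- t is obtained from s by a k-Fibonacci move (k ∈ Δ_n):
-- pegs X, Y, Z pairwise distinct, X = k X̃, Y = Δ_{k-1} Ỹ, Z only has
-- disks > k (automatic since all disks ≤ k are on X or Y);
-- the result puts disks k-1 and k onto Z, everything else unchanged.
FibMove : (n k : ℕ) → State n → State n → Set
FibMove n k s t =
  1 ≤ k × k ≤ n ×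
  Σ Peg λ X → Σ Peg λ Y → Σ Peg λ Z →
    X ≢ Y × Y ≢ Z × X ≢ Z ×
    (∀ i → disk i ≡ k → s i ≡ X) ×
    (∀ i → disk i < k → s i ≡ Y) ×
    (∀ i → (disk i ≡ k ⊎ disk i ≡ k ∸ 1) → t i ≡ Z) ×
    (∀ i → disk i ≢ k → disk i ≢ k ∸ 1 → t i ≡ s i)

Step : (n : ℕ) → State n → State n → Set
Step n s t = Σ ℕ λ k → FibMove n k s t

IsSolution : (n L : ℕ) → (ℕ → State n) → Set
IsSolution n L s =
  (∀ i → s 0 i ≡ pegA) ×
  (∀ i → s L i ≡ pegC) ×
  (∀ m → m < L → Step n (s m) (s (suc m)))

IsOptimalSolution : (n L : ℕ) → (ℕ → State n) → Set
IsOptimalSolution n L s =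
  IsSolution n L s ×
  (∀ L' (s' : ℕ → State n) → IsSolution n L' s' → L ≤ L')

-- A potential dist m s P, which vanishes on a tower on P and drops by at most one per move,
-- bounds the number of moves still needed. Since the recursive solution has F_{n+2} − 1 moves,
-- an optimal solution has no more, and the potential then forces it to be the recursive one:
-- disks 1,…,n−1 go to the spare peg in F_{n+1} − 1 moves, a single move of disk n (carrying
-- n−1) lands on the target, and disks 1,…,n−2 follow in F_n − 1 moves. So its i-th move
-- moves disk label n i. The Zeckendorf expansions of i and i+1 obey the same recursion: their
-- digits at index n+1 differ exactly when i+1 = F_{n+1}; before that step both expansions stop
-- at index n, after it both contain F_{n+1} and the rest stops at index n−1. Hence
-- label n (k−1) = j − 1.
module Submission where

open import Defs
open import Data.Nat using (ℕ; zero; suc; _+_; _∸_; _≤_; _<_; _⊓_; z≤n; s≤s; s≤s⁻¹; _≤?_; _<?_)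
open import Data.Nat.Properties hiding (_≟_)
open import Data.Bool using (Bool; true; false; if_then_else_)
open import Data.Bool.Properties using (¬-not)
open import Data.Fin using (Fin; toℕ; fromℕ<; _≟_) renaming (zero to fz; suc to fs)
open import Data.Fin.Properties using (all?; toℕ<n; toℕ-fromℕ<; fromℕ<-toℕ)
open import Data.Product using (Σ; _×_; _,_; proj₁; proj₂)
open import Data.Sum using (_⊎_; inj₁; inj₂; [_,_]′)
open import Relation.Binary.Definitions using (tri<; tri≈; tri>)
open import Relation.Nullary using (¬_; Dec; ¬?; _→-dec_; does; yes; no; contradiction)
open import Relation.Nullary.Decidable using (from-yes; dec-true; dec-false)
open import Relation.Binary.PropositionalEquality
  using (_≡_; _≢_; refl; sym; trans; cong; cong₂; subst; subst₂; module ≡-Reasoning)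

private variable
  m N k ℓ : ℕ
  P Q R : Peg

third : Peg → Peg → Peg
third fz           (fs fz)      = fs (fs fz)
third fz           (fs (fs fz)) = fs fz
third (fs fz)      fz           = fs (fs fz)
third (fs fz)      (fs (fs fz)) = fz
third (fs (fs fz)) fz           = fs fz
third (fs (fs fz)) (fs fz)      = fz
third _            _            = fz

third-≢ˡ : P ≢ Q → third P Q ≢ P
third-≢ˡ {P} {Q} = from-yes (all? λ P → all? λ Q → ¬? (P ≟ Q) →-dec ¬? (third P Q ≟ P)) P Q

third-≢ʳ : P ≢ Q → third P Q ≢ Q
third-≢ʳ {P} {Q} = from-yes (all? λ P → all? λ Q → ¬? (P ≟ Q) →-dec ¬? (third P Q ≟ Q)) P Q

third-unique : P ≢ Q → R ≢ P → R ≢ Q → R ≡ third P Q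
third-unique {P} {Q} {R} = from-yes
  (all? λ P → all? λ Q → all? λ R → ¬? (P ≟ Q) →-dec ¬? (R ≟ P) →-dec ¬? (R ≟ Q) →-dec (R ≟ third P Q)) P Q R

optimalLength : ℕ → ℕ
optimalLength zero    = 0
optimalLength (suc m) = fib (suc m) + optimalLength m

suc-optimalLength : ∀ m → suc (optimalLength m) ≡ fib (suc (suc m))
suc-optimalLength zero    = refl
suc-optimalLength (suc m) = begin
  suc (fib (suc m) + optimalLength m) ≡⟨ +-suc (fib (suc m)) (optimalLength m) ⟨
  fib (suc m) + suc (optimalLength m) ≡⟨ cong (fib (suc m) +_) (suc-optimalLength m) ⟩
  fib (suc m) + fib (suc (suc m))     ≡⟨ +-comm (fib (suc m)) (fib (suc (suc m))) ⟩
  fib (suc (suc (suc m)))             ∎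
  where open ≡-Reasoning

optimalLength-suc-suc : ∀ m → optimalLength (suc (suc m)) ≡ suc (optimalLength (suc m)) + optimalLength m
optimalLength-suc-suc m = begin
  fib (suc (suc m)) + optimalLength (suc m)     ≡⟨ cong (_+ optimalLength (suc m)) (suc-optimalLength m) ⟨
  suc (optimalLength m) + optimalLength (suc m) ≡⟨ +-comm (suc (optimalLength m)) (optimalLength (suc m)) ⟩
  optimalLength (suc m) + suc (optimalLength m) ≡⟨ +-suc (optimalLength (suc m)) (optimalLength m) ⟩
  suc (optimalLength (suc m)) + optimalLength m ∎
  where open ≡-Reasoning

optimalLength-suc<suc-suc : ∀ m → optimalLength (suc m) < optimalLength (suc (suc m))
optimalLength-suc<suc-suc m = ≤-trans (s≤s (m≤m+n _ _)) (≤-reflexive (sym (optimalLength-suc-suc m)))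

optimalLength-suc-suc-∸ : ∀ m → optimalLength (suc (suc m)) ∸ suc (optimalLength (suc m)) ≡ optimalLength m
optimalLength-suc-suc-∸ m = trans (cong (_∸ suc (optimalLength (suc m))) (optimalLength-suc-suc m))
                                  (m+n∸m≡n (suc (optimalLength (suc m))) (optimalLength m))

-- Peg of each disk d ≥ 1; the values at 0 and beyond the last disk are junk.
Config : Set
Config = ℕ → Peg

-- FibMove restated for ℕ-indexed configurations, so that towers of all heights share one type.
record Move (N k : ℕ) (s t : Config) : Set where
  field
    1≤k   : 1 ≤ k
    k≤N   : k ≤ N
    X Y Z : Peg
    X≢Y   : X ≢ Y
    Y≢Z   : Y ≢ Z
    X≢Z   : X ≢ Z
    source : s k ≡ X
    spare  : ∀ d → 1 ≤ d → d < k → s d ≡ Y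
    target : t k ≡ Z
    target-pred : 2 ≤ k → t (k ∸ 1) ≡ Z
    frame  : ∀ d → 1 ≤ d → d ≤ N → d ≢ k → d ≢ k ∸ 1 → t d ≡ s d

Move-relabel : ∀ {k′ s t} → k′ ≡ k → Move N k s t → Move N k′ s t
Move-relabel refl move = move

Tower : ℕ → Config → Peg → Set
Tower m s P = ∀ d → 1 ≤ d → d ≤ m → s d ≡ P

Tower-pred : ∀ {s} → Tower (suc m) s P → Tower m s P
Tower-pred tower d 1≤d d≤m = tower d 1≤d (m≤n⇒m≤1+n d≤m)

-- A lower bound on the number of moves gathering disks 1,…,m on P; opaque so that Agda
-- infers its arguments from the three equations below.
opaque
  dist : ℕ → Config → Peg → ℕ
  dist zero    s P = 0
  dist (suc m) s P =
    if does (s (suc m) ≟ P) then dist m s P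
    else fib (suc m) + (dist m s P ⊓ dist m s (third (s (suc m)) P))

  dist-zero : ∀ {s} → dist zero s P ≡ 0
  dist-zero = refl

  dist-here : ∀ {s} → s (suc m) ≡ P → dist (suc m) s P ≡ dist m s P
  dist-here {m} {P} {s} on-P rewrite dec-true (s (suc m) ≟ P) on-P = refl

  dist-away : ∀ {s} → s (suc m) ≢ P →
    dist (suc m) s P ≡ fib (suc m) + (dist m s P ⊓ dist m s (third (s (suc m)) P))
  dist-away {m} {P} {s} off-P rewrite dec-false (s (suc m) ≟ P) off-P = refl

module _ {s : Config} where

  fib≤dist-away : s (suc m) ≢ P → fib (suc m) ≤ dist (suc m) s P
  fib≤dist-away off-P = ≤-trans (m≤m+n _ _) (≤-reflexive (sym (dist-away off-P)))

  dist-tower-self : Tower m s P → dist m s P ≡ 0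
  dist-tower-self {zero}  tower = dist-zero
  dist-tower-self {suc m} tower =
    trans (dist-here (tower (suc m) (s≤s z≤n) ≤-refl)) (dist-tower-self (Tower-pred tower))

  dist-tower-other : Tower m s Q → Q ≢ P → dist m s P ≡ optimalLength m
  dist-tower-other {zero}  tower Q≢P = dist-zero
  dist-tower-other {suc m} {Q} {P} tower Q≢P = begin
    dist (suc m) s P
      ≡⟨ dist-away {s = s} off-P ⟩
    fib (suc m) + (dist m s P ⊓ dist m s (third (s (suc m)) P))
      ≡⟨ cong (λ X → fib (suc m) + (dist m s P ⊓ dist m s (third X P))) on-Q ⟩
    fib (suc m) + (dist m s P ⊓ dist m s (third Q P))
      ≡⟨ cong₂ (λ x y → fib (suc m) + (x ⊓ y)) (dist-tower-other below Q≢P)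
                                               (dist-tower-other below (λ e → third-≢ˡ Q≢P (sym e))) ⟩
    fib (suc m) + (optimalLength m ⊓ optimalLength m)
      ≡⟨ cong (fib (suc m) +_) (⊓-idem (optimalLength m)) ⟩
    optimalLength (suc m) ∎
    where
    open ≡-Reasoning
    on-Q : s (suc m) ≡ Q
    on-Q = tower (suc m) (s≤s z≤n) ≤-refl
    off-P : s (suc m) ≢ P
    off-P e = Q≢P (trans (sym on-Q) e)
    below : Tower m s Q
    below = Tower-pred tower

-- Right after disk m+1 has moved, disk m lies on it, so both disks are away from Q.
dist-after-top-move : ∀ {s t} → Move N (suc m) s t → t (suc m) ≢ Q → fib (suc (suc m)) ≤ dist (suc m) t Q
dist-after-top-move {m = zero}  move off-Q = fib≤dist-away off-Q
dist-after-top-move {m = suc m} {Q = Q} {t = t} move off-Q =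
  ≤-trans (+-monoʳ-≤ (fib (suc (suc m))) (⊓-glb (fib≤dist-away off-Q′) (fib≤dist-away off-third)))
          (≤-reflexive (sym (dist-away off-Q)))
  where
  open Move move
  same-peg : t (suc m) ≡ t (suc (suc m))
  same-peg = trans (target-pred (s≤s (s≤s z≤n))) (sym target)
  off-Q′ : t (suc m) ≢ Q
  off-Q′ e = off-Q (trans (sym same-peg) e)
  off-third : t (suc m) ≢ third (t (suc (suc m))) Q
  off-third e = third-≢ˡ off-Q (trans (sym e) same-peg)

unmoved-above : ∀ {s t d} → Move N k s t → k < d → d ≤ N → t d ≡ s d
unmoved-above {k = k} move k<d d≤N =
  frame _ (≤-trans 1≤k (<⇒≤ k<d)) d≤N (λ e → <⇒≢ k<d (sym e)) (λ e → <⇒≢ (≤-<-trans (m∸n≤m k 1) k<d) (sym e))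
  where open Move move

spare-before : ∀ {s t} (move : Move N (suc m) s t) → Tower m s (Move.Y move)
spare-before move d 1≤d d≤m = Move.spare move d 1≤d (s≤s d≤m)

spare-after : ∀ {s t} (move : Move N (suc (suc m)) s t) → Tower m t (Move.Y move)
spare-after move d 1≤d d≤m =
  trans (frame d 1≤d (≤-trans d≤m (≤-trans (n≤1+n _) (≤-trans (n≤1+n _) k≤N)))
               (λ e → <⇒≢ (≤-trans (s≤s d≤m) (n≤1+n _)) e) (λ e → <⇒≢ (s≤s d≤m) e))
        (spare d 1≤d (s≤s (m≤n⇒m≤1+n d≤m)))
  where open Move move

dist-step-below : ∀ {s t} → t (suc m) ≡ s (suc m) → (∀ P → dist m s P ≤ suc (dist m t P)) →
  ∀ P → dist (suc m) s P ≤ suc (dist (suc m) t P)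
dist-step-below {m} {s} {t} same step P with s (suc m) ≟ P
... | yes on-P = begin
  dist (suc m) s P      ≡⟨ dist-here on-P ⟩
  dist m s P            ≤⟨ step P ⟩
  suc (dist m t P)      ≡⟨ cong suc (dist-here (trans same on-P)) ⟨
  suc (dist (suc m) t P) ∎
  where open ≤-Reasoning
... | no off-P = begin
  dist (suc m) s P
    ≡⟨ dist-away off-P ⟩
  fib (suc m) + (dist m s P ⊓ dist m s P′)
    ≤⟨ +-monoʳ-≤ (fib (suc m)) (⊓-mono-≤ (step P) (step P′)) ⟩
  fib (suc m) + suc (dist m t P ⊓ dist m t P′)
    ≡⟨ +-suc (fib (suc m)) _ ⟩
  suc (fib (suc m) + (dist m t P ⊓ dist m t P′))
    ≡⟨ cong (λ X → suc (fib (suc m) + (dist m t P ⊓ dist m t (third X P)))) same ⟨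
  suc (fib (suc m) + (dist m t P ⊓ dist m t (third (t (suc m)) P)))
    ≡⟨ cong suc (dist-away (λ e → off-P (trans (sym same) e))) ⟨
  suc (dist (suc m) t P) ∎
  where
  open ≤-Reasoning
  P′ : Peg
  P′ = third (s (suc m)) P

fib≤suc-dist-after-top-move : ∀ {s t} → Move N (suc m) s t → ∀ P → fib (suc m) ≤ suc (dist (suc m) t P)
fib≤suc-dist-after-top-move {m = m} move P with Move.Z move ≟ P
... | no Z≢P = m≤n⇒m≤1+n (fib≤dist-away (λ e → Z≢P (trans (sym (Move.target move)) e)))
fib≤suc-dist-after-top-move {m = zero} move P | yes Z≡P =
  ≤-reflexive (cong suc (sym (trans (dist-here (trans (Move.target move) Z≡P)) dist-zero)))
fib≤suc-dist-after-top-move {m = suc m} {t = t} move P | yes Z≡P = begin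
  fib (suc (suc m))      ≡⟨ suc-optimalLength m ⟨
  suc (optimalLength m)  ≡⟨ cong suc (dist-tower-other (spare-after move) Y≢P) ⟨
  suc (dist m t P)       ≡⟨ cong suc (dist-here (trans (Move.target-pred move (s≤s (s≤s z≤n))) Z≡P)) ⟨
  suc (dist (suc m) t P) ≡⟨ cong suc (dist-here (trans (Move.target move) Z≡P)) ⟨
  suc (dist (suc (suc m)) t P) ∎
  where
  open ≤-Reasoning
  Y≢P : Move.Y move ≢ P
  Y≢P e = Move.Y≢Z move (trans e (sym Z≡P))

dist-top-move : ∀ {s t} → Move N (suc m) s t → ∀ P → dist (suc m) s P ≤ suc (dist (suc m) t P)
dist-top-move {m = m} {s = s} {t = t} move P with Move.X move ≟ P
... | yes X≡P = begin
  dist (suc m) s P       ≡⟨ dist-here (trans source X≡P) ⟩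
  dist m s P             ≡⟨ dist-tower-other (spare-before move) (λ e → X≢Y (trans X≡P (sym e))) ⟩
  optimalLength m        <⟨ ≤-reflexive (suc-optimalLength m) ⟩
  fib (suc (suc m))      ≤⟨ dist-after-top-move move (λ e → X≢Z (trans X≡P (sym (trans (sym target) e)))) ⟩
  dist (suc m) t P       ≤⟨ n≤1+n _ ⟩
  suc (dist (suc m) t P) ∎
  where
  open Move move
  open ≤-Reasoning
... | no X≢P = begin
  dist (suc m) s P
    ≡⟨ dist-away (λ e → X≢P (trans (sym source) e)) ⟩
  fib (suc m) + (dist m s P ⊓ dist m s (third (s (suc m)) P))
    ≡⟨ cong (λ x → fib (suc m) + (dist m s P ⊓ dist m s (third x P))) source ⟩
  fib (suc m) + (dist m s P ⊓ dist m s (third X P))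
    ≡⟨ cong (fib (suc m) +_) spare-gathered ⟩
  fib (suc m) + 0
    ≡⟨ +-identityʳ (fib (suc m)) ⟩
  fib (suc m)
    ≤⟨ fib≤suc-dist-after-top-move move P ⟩
  suc (dist (suc m) t P) ∎
  where
  open Move move
  open ≤-Reasoning
  -- the spare peg Y, where disks 1,…,m sit, is P or the third peg
  spare-gathered : dist m s P ⊓ dist m s (third X P) ≡ 0
  spare-gathered with Y ≟ P
  ... | yes Y≡P = cong (_⊓ dist m s (third X P)) (dist-tower-self (subst (Tower m s) Y≡P (spare-before move)))
  ... | no Y≢P  = trans (cong (dist m s P ⊓_) (dist-tower-self (subst (Tower m s) Y≡third (spare-before move))))
                        (⊓-zeroʳ (dist m s P))
    where
    Y≡third : Y ≡ third X P
    Y≡third = third-unique X≢P (λ e → X≢Y (sym e)) Y≢P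

dist-move : ∀ {s t} → Move N k s t → k ≤ m → m ≤ N → ∀ P → dist m s P ≤ suc (dist m t P)
dist-move {m = zero}  move k≤m m≤N P = ≤-trans (≤-reflexive dist-zero) z≤n
dist-move {m = suc m} move k≤m m≤N P with m≤n⇒m<n∨m≡n k≤m
... | inj₁ (s≤s k≤m′) = dist-step-below (unmoved-above move (s≤s k≤m′) m≤N)
                                        (dist-move move k≤m′ (≤-trans (n≤1+n m) m≤N)) P
... | inj₂ refl       = dist-top-move move P

record Run (N m : ℕ) (S : ℕ → Config) (lab : ℕ → ℕ) (ℓ : ℕ) : Set where
  field
    label≤ : ∀ i → i < ℓ → lab i ≤ m
    step   : ∀ i → i < ℓ → Move N (lab i) (S i) (S (suc i))

private variable
  S : ℕ → Config
  lab : ℕ → ℕ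

open Run

Run-prefix : ∀ {t} → t ≤ ℓ → Run N m S lab ℓ → Run N m S lab t
Run-prefix t≤ℓ run .label≤ i i<t = label≤ run i (≤-trans i<t t≤ℓ)
Run-prefix t≤ℓ run .step   i i<t = step run i (≤-trans i<t t≤ℓ)

Run-drop : ∀ b → Run N m S lab (b + ℓ) → Run N m (λ i → S (b + i)) (λ i → lab (b + i)) ℓ
Run-drop b run .label≤ i i<ℓ = label≤ run (b + i) (+-monoʳ-< b i<ℓ)
Run-drop {N = N} {S = S} {lab = lab} b run .step i i<ℓ =
  subst (λ j → Move N (lab (b + i)) (S (b + i)) (S j)) (sym (+-suc b i)) (step run (b + i) (+-monoʳ-< b i<ℓ))

Run-after : ∀ {t} → t < ℓ → Run N m S lab ℓ →
  Run N m (λ i → S (suc t + i)) (λ i → lab (suc t + i)) (ℓ ∸ suc t)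
Run-after {N = N} {m = m} {S = S} {lab = lab} {t = t} t<ℓ run =
  Run-drop (suc t) (subst (Run N m S lab) (sym (m+[n∸m]≡n t<ℓ)) run)

Run-below : Run N (suc m) S lab ℓ → (∀ i → i < ℓ → lab i ≢ suc m) → Run N m S lab ℓ
Run-below run no-top .label≤ i i<ℓ with m≤n⇒m<n∨m≡n (label≤ run i i<ℓ)
... | inj₁ (s≤s lab≤m) = lab≤m
... | inj₂ lab≡        = contradiction lab≡ (no-top i i<ℓ)
Run-below run no-top .step = step run

Run-fixed-above : Run N m S lab ℓ → ∀ {d} → m < d → d ≤ N → ∀ {i} → i ≤ ℓ → S i d ≡ S 0 d
Run-fixed-above run m<d d≤N {zero}  i≤ℓ = refl
Run-fixed-above run m<d d≤N {suc i} i<ℓ =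
  trans (unmoved-above (step run i i<ℓ) (≤-<-trans (label≤ run i i<ℓ) m<d) d≤N)
        (Run-fixed-above run m<d d≤N (<⇒≤ i<ℓ))

dist≤length : m ≤ N → Run N m S lab ℓ → Tower m (S ℓ) P → dist m (S 0) P ≤ ℓ
dist≤length {ℓ = zero}  m≤N run tower = ≤-reflexive (dist-tower-self tower)
dist≤length {ℓ = suc ℓ} m≤N run tower =
  ≤-trans (dist-move (step run 0 (s≤s z≤n)) (label≤ run 0 (s≤s z≤n)) m≤N _)
          (s≤s (dist≤length m≤N (Run-drop 1 run) tower))

dist≤remaining : m ≤ N → Run N m S lab ℓ → Tower m (S ℓ) P → ∀ {t} → t < ℓ →
  dist m (S (suc t)) P ≤ ℓ ∸ suc t
dist≤remaining {m = m} {S = S} {ℓ = ℓ} {P = P} m≤N run tower {t} t<ℓ =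
  subst (λ x → dist m (S x) P ≤ ℓ ∸ suc t) (+-identityʳ (suc t))
    (dist≤length m≤N (Run-after t<ℓ run)
      (subst (λ x → Tower m (S x) P) (sym (m+[n∸m]≡n t<ℓ)) tower))

moved-disk : ∀ {s t} → Move N k s t → t k ≢ s k
moved-disk move e = Move.X≢Z move (trans (sym (Move.source move)) (trans (sym e) (Move.target move)))

Move-label-unique : ∀ {k′ s t} → Move N k s t → Move N k′ s t → k ≡ k′
Move-label-unique {k = k} {k′} move move′ with <-cmp k k′
... | tri< k<k′ _ _ = contradiction (unmoved-above move k<k′ (Move.k≤N move′)) (moved-disk move′)
... | tri≈ _ k≡k′ _ = k≡k′
... | tri> _ _ k′<k = contradiction (unmoved-above move′ k′<k (Move.k≤N move)) (moved-disk move)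

first-below : (A : ℕ → Set) → (∀ i → Dec (A i)) → ∀ ℓ →
  (∀ i → i < ℓ → ¬ A i) ⊎ Σ ℕ λ t → t < ℓ × A t × (∀ i → i < t → ¬ A i)
first-below A A? zero = inj₁ λ i ()
first-below A A? (suc ℓ) with first-below A A? ℓ
... | inj₂ (t , t<ℓ , At , none-before) = inj₂ (t , m≤n⇒m≤1+n t<ℓ , At , none-before)
... | inj₁ none with A? ℓ
...   | yes Aℓ = inj₂ (ℓ , ≤-refl , Aℓ , none)
...   | no ¬Aℓ = inj₁ λ i i<1+ℓ →
  [ none i , (λ { refl → ¬Aℓ }) ]′ (m≤n⇒m<n∨m≡n (s≤s⁻¹ i<1+ℓ))

-- label m i is the disk moved at step i of the canonical transfer of disks 1,…,m:
-- disks 1,…,m-1 go to the spare peg, disk m moves (carrying m-1), then disks 1,…,m-2 follow.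
label : ℕ → ℕ → ℕ
label zero          i = 0
label (suc zero)    i = 1
label (suc (suc m)) i =
  if does (i <? optimalLength (suc m)) then label (suc m) i
  else if does (i ≤? optimalLength (suc m)) then suc (suc m)
  else label m (i ∸ suc (optimalLength (suc m)))

module _ {i : ℕ} (m : ℕ) where

  label-early : i < optimalLength (suc m) → label (suc (suc m)) i ≡ label (suc m) i
  label-early i< rewrite dec-true (i <? optimalLength (suc m)) i< = refl

  label-middle : i ≡ optimalLength (suc m) → label (suc (suc m)) i ≡ suc (suc m)
  label-middle refl rewrite dec-false (optimalLength (suc m) <? optimalLength (suc m)) (<-irrefl refl)
                          | dec-true (optimalLength (suc m) ≤? optimalLength (suc m)) ≤-refl = refl

  label-late : optimalLength (suc m) < i → label (suc (suc m)) i ≡ label m (i ∸ suc (optimalLength (suc m)))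
  label-late >i rewrite dec-false (i <? optimalLength (suc m)) (<-asym >i)
                      | dec-false (i ≤? optimalLength (suc m)) (<⇒≱ >i) = refl

label-phases : ∀ m {lab : ℕ → ℕ} {t ℓ} → t ≡ optimalLength (suc m) →
  (∀ i → i < t → lab i ≡ label (suc m) i) → lab t ≡ suc (suc m) →
  (∀ i → i < ℓ ∸ suc t → lab (suc t + i) ≡ label m i) →
  ∀ i → i < ℓ → lab i ≡ label (suc (suc m)) i
label-phases m {lab} refl first middle second i i<ℓ with <-cmp i (optimalLength (suc m))
... | tri< i<t _ _  = trans (first i i<t) (sym (label-early m i<t))
... | tri≈ _ refl _ = trans middle (sym (label-middle m refl))
... | tri> _ _ t<i  = begin
  lab i                                       ≡⟨ cong lab (m+[n∸m]≡n t<i) ⟨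
  lab (suc A + (i ∸ suc A))                   ≡⟨ second (i ∸ suc A) (∸-monoˡ-< i<ℓ t<i) ⟩
  label m (i ∸ suc A)                         ≡⟨ label-late m t<i ⟨
  label (suc (suc m)) i                       ∎
  where
  open ≡-Reasoning
  A : ℕ
  A = optimalLength (suc m)

ShortTransfersCanonical : ℕ → Set
ShortTransfersCanonical m =
  ∀ {N S lab ℓ P Q} → m ≤ N → P ≢ Q → Run N m S lab ℓ → Tower m (S 0) P → Tower m (S ℓ) Q →
  ℓ ≤ optimalLength m → ℓ ≡ optimalLength m × (∀ i → i < ℓ → lab i ≡ label m i)

step-of : ∀ {t} → Run N m S lab ℓ → t < ℓ → lab t ≡ k → Move N k (S t) (S (suc t))
step-of run t<ℓ lab≡ = Move-relabel (sym lab≡) (Run.step run _ t<ℓ)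

cost-of-top-move-away : suc m ≤ N → Run N (suc m) S lab ℓ → Tower (suc m) (S ℓ) Q →
  ∀ {t} → t < ℓ → lab t ≡ suc m → S (suc t) (suc m) ≢ Q → fib (suc (suc m)) ≤ ℓ ∸ suc t
cost-of-top-move-away M≤N run tower t<ℓ top off-Q =
  ≤-trans (dist-after-top-move (step-of run t<ℓ top) off-Q) (dist≤remaining M≤N run tower t<ℓ)

no-room : ∀ {f g t ℓ} → t < ℓ → f ≤ g → ℓ ≤ f + t → ¬ g ≤ ℓ ∸ suc t
no-room {f} {g} {t} {ℓ} t<ℓ f≤g ℓ≤ g≤ = <-irrefl refl (begin-strict
  t + g              <⟨ s≤s (+-monoʳ-≤ t g≤) ⟩
  suc t + (ℓ ∸ suc t) ≡⟨ m+[n∸m]≡n t<ℓ ⟩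
  ℓ                  ≤⟨ ℓ≤ ⟩
  f + t              ≤⟨ +-monoˡ-≤ t f≤g ⟩
  g + t              ≡⟨ +-comm g t ⟩
  t + g              ∎)
  where open ≤-Reasoning

module _ (M≤N : suc m ≤ N) (run : Run N (suc m) S lab ℓ)
         (start : Tower (suc m) (S 0) P) (end : Tower (suc m) (S ℓ) Q) where

  -- Landing elsewhere would leave F_{m+2} more moves to make (cost-of-top-move-away).
  late-top-move-lands : ℓ ≤ optimalLength (suc m) → ∀ {t} → optimalLength m ≤ t → t < ℓ →
    lab t ≡ suc m → S (suc t) (suc m) ≡ Q
  late-top-move-lands ℓ≤ {t} lb t<ℓ top with S (suc t) (suc m) ≟ Q
  ... | yes on-Q = on-Q
  ... | no off-Q = contradiction (cost-of-top-move-away M≤N run end t<ℓ top off-Q)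
                     (no-room t<ℓ (m≤m+n _ _) (≤-trans ℓ≤ (+-monoʳ-≤ (fib (suc m)) lb)))

  top-starts-on-P : ∀ {t} → t < ℓ → (∀ i → i < t → lab i ≢ suc m) → S t (suc m) ≡ P
  top-starts-on-P t<ℓ first =
    trans (Run-fixed-above (Run-below (Run-prefix (<⇒≤ t<ℓ) run) first) ≤-refl M≤N ≤-refl)
          (start (suc m) (s≤s z≤n) ≤-refl)

  module _ (ℓ≤ : ℓ ≤ optimalLength (suc m)) {t} (t<ℓ : t < ℓ) (top : lab t ≡ suc m)
           (first : ∀ i → i < t → lab i ≢ suc m) where

    first-top-move-waits : optimalLength m ≤ t
    first-top-move-waits = subst (_≤ t) (dist-tower-other (Tower-pred start) P≢Y)
      (dist≤length (≤-trans (n≤1+n m) M≤N) (Run-below (Run-prefix (<⇒≤ t<ℓ) run) first) (spare-before move))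
      where
      move : Move N (suc m) (S t) (S (suc t))
      move = step-of run t<ℓ top
      P≢Y : P ≢ Move.Y move
      P≢Y P≡Y = Move.X≢Y move (trans (sym (Move.source move)) (trans (top-starts-on-P t<ℓ first) P≡Y))

    first-top-move-lands : S (suc t) (suc m) ≡ Q
    first-top-move-lands = late-top-move-lands ℓ≤ first-top-move-waits t<ℓ top

    -- A second move of disk m+1 would start from Q and so land away from it, too late.
    first-top-move-last : ∀ i → i < ℓ ∸ suc t → lab (suc t + i) ≢ suc m
    first-top-move-last
      with first-below (λ i → lab (suc t + i) ≡ suc m) (λ i → lab (suc t + i) Data.Nat.≟ suc m) (ℓ ∸ suc t)
    ... | inj₁ none = none
    ... | inj₂ (i , i< , top′ , first′) =
      contradiction (trans (late-top-move-lands ℓ≤ waits′ t′<ℓ top′) (sym still-on-Q))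
                    (moved-disk (step-of run t′<ℓ top′))
      where
      waits′ : optimalLength m ≤ suc t + i
      waits′ = ≤-trans first-top-move-waits (≤-trans (n≤1+n t) (m≤m+n (suc t) i))
      t′<ℓ : suc t + i < ℓ
      t′<ℓ = ≤-trans (+-monoʳ-< (suc t) i<) (≤-reflexive (m+[n∸m]≡n t<ℓ))
      still-on-Q : S (suc t + i) (suc m) ≡ Q
      still-on-Q =
        trans (Run-fixed-above (Run-below (Run-prefix (<⇒≤ i<) (Run-after t<ℓ run)) first′) ≤-refl M≤N ≤-refl)
              (trans (cong (λ x → S x (suc m)) (+-identityʳ (suc t))) first-top-move-lands)

transfer-onto-placed-disk : ShortTransfersCanonical m → suc m ≤ N → R ≢ Q → Run N (suc m) S lab ℓ →
  S 0 (suc m) ≡ Q → Tower m (S 0) R → Tower (suc m) (S ℓ) Q → ℓ ≤ optimalLength m →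
  ℓ ≡ optimalLength m × (∀ i → i < ℓ → lab i ≡ label m i)
transfer-onto-placed-disk {m} {Q = Q} {S = S} {lab = lab} {ℓ = ℓ} canonical M≤N R≢Q run placed start end ℓ≤
  with first-below (λ i → lab i ≡ suc m) (λ i → lab i Data.Nat.≟ suc m) ℓ
... | inj₁ none = canonical (≤-trans (n≤1+n m) M≤N) R≢Q (Run-below run none) start (Tower-pred end) ℓ≤
... | inj₂ (t , t<ℓ , top , first) = contradiction (cost-of-top-move-away M≤N run end t<ℓ top off-Q) too-costly
  where
  off-Q : S (suc t) (suc m) ≢ Q
  off-Q e = moved-disk (step-of run t<ℓ top) (trans e (sym (trans still-placed placed)))
    where
    still-placed : S t (suc m) ≡ S 0 (suc m)
    still-placed = Run-fixed-above (Run-below (Run-prefix (<⇒≤ t<ℓ) run) first) ≤-refl M≤N ≤-refl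
  too-costly : ¬ fib (suc (suc m)) ≤ ℓ ∸ suc t
  too-costly ≤rest = <-irrefl refl
    (≤-trans (≤-reflexive (suc-optimalLength m)) (≤-trans ≤rest (≤-trans (m∸n≤m ℓ (suc t)) ℓ≤)))

-- The first move of the largest disk splits the transfer into two shorter ones:
-- disks 1,…,m+1 from P to the spare peg Y, then disks 1,…,m from Y onto Q.
short-transfers-canonical-step :
  ShortTransfersCanonical (suc m) → ShortTransfersCanonical m → ShortTransfersCanonical (suc (suc m))
short-transfers-canonical-step {m} canonical₁ canonical₀ {N} {S} {lab} {ℓ} {P} {Q} M≤N P≢Q run start end ℓ≤
  with first-below (λ i → lab i ≡ suc (suc m)) (λ i → lab i Data.Nat.≟ suc (suc m)) ℓ
... | inj₁ none = contradiction (begin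
  P                  ≡⟨ start (suc (suc m)) (s≤s z≤n) ≤-refl ⟨
  S 0 (suc (suc m))  ≡⟨ Run-fixed-above (Run-below run none) ≤-refl M≤N ≤-refl ⟨
  S ℓ (suc (suc m))  ≡⟨ end (suc (suc m)) (s≤s z≤n) ≤-refl ⟩
  Q                  ∎) P≢Q
  where open ≡-Reasoning
... | inj₂ (t , t<ℓ , top , first) = length , labels
  where
  move : Move N (suc (suc m)) (S t) (S (suc t))
  move = step-of run t<ℓ top
  open Move move
  m≤N : suc m ≤ N
  m≤N = ≤-trans (n≤1+n _) M≤N
  Z≡Q : Z ≡ Q
  Z≡Q = trans (sym target) (first-top-move-lands M≤N run start end ℓ≤ t<ℓ top first)
  ℓ′ : ℕ
  ℓ′ = ℓ ∸ suc t
  split : suc t + ℓ′ ≡ ℓ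
  split = m+[n∸m]≡n t<ℓ
  bound : suc t + ℓ′ ≤ suc (optimalLength (suc m)) + optimalLength m
  bound = ≤-trans (≤-reflexive split) (≤-trans ℓ≤ (≤-reflexive (optimalLength-suc-suc m)))
  second : ℓ′ ≡ optimalLength m × (∀ i → i < ℓ′ → lab (suc t + i) ≡ label m i)
  second = transfer-onto-placed-disk canonical₀ m≤N (λ Y≡Q → Y≢Z (trans Y≡Q (sym Z≡Q)))
    (Run-below (Run-after t<ℓ run) (first-top-move-last M≤N run start end ℓ≤ t<ℓ top first))
    (trans (cong (λ x → S x (suc m)) (+-identityʳ (suc t))) (trans (target-pred (s≤s (s≤s z≤n))) Z≡Q))
    (subst (λ x → Tower m (S x) Y) (sym (+-identityʳ (suc t))) (spare-after move))
    (Tower-pred (subst (λ x → Tower (suc (suc m)) (S x) Q) (sym split) end))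
    (+-cancelˡ-≤ (suc (optimalLength (suc m))) ℓ′ (optimalLength m)
      (≤-trans (+-monoˡ-≤ ℓ′ (s≤s (first-top-move-waits M≤N run start end ℓ≤ t<ℓ top first))) bound))
  P≢Y : P ≢ Y
  P≢Y P≡Y = X≢Y (trans (sym source) (trans (top-starts-on-P M≤N run start end t<ℓ first) P≡Y))
  first-phase : t ≡ optimalLength (suc m) × (∀ i → i < t → lab i ≡ label (suc m) i)
  first-phase = canonical₁ m≤N P≢Y (Run-below (Run-prefix (<⇒≤ t<ℓ) run) first)
                           (Tower-pred start) (spare-before move)
    (s≤s⁻¹ (+-cancelʳ-≤ (optimalLength m) (suc t) (suc (optimalLength (suc m)))
      (subst (λ x → suc t + x ≤ suc (optimalLength (suc m)) + optimalLength m) (proj₁ second) bound)))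
  length : ℓ ≡ optimalLength (suc (suc m))
  length = begin
    ℓ                                              ≡⟨ split ⟨
    suc t + ℓ′                                     ≡⟨ cong₂ (λ x y → suc x + y) (proj₁ first-phase) (proj₁ second) ⟩
    suc (optimalLength (suc m)) + optimalLength m  ≡⟨ optimalLength-suc-suc m ⟨
    optimalLength (suc (suc m))                    ∎
    where open ≡-Reasoning
  labels : ∀ i → i < ℓ → lab i ≡ label (suc (suc m)) i
  labels = label-phases m (proj₁ first-phase) (proj₂ first-phase) top (proj₂ second)

short-transfers-canonical : ∀ m → ShortTransfersCanonical m
short-transfers-canonical zero _ _ _ _ _ z≤n = refl , λ i ()
short-transfers-canonical (suc zero) {ℓ = zero} M≤N P≢Q run start end ℓ≤ =
  contradiction (trans (sym (start 1 ≤-refl ≤-refl)) (end 1 ≤-refl ≤-refl)) P≢Q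
short-transfers-canonical (suc zero) {ℓ = suc zero} M≤N P≢Q run start end ℓ≤ =
  refl , λ i i<1 → ≤-antisym (Run.label≤ run i i<1) (Move.1≤k (Run.step run i i<1))
short-transfers-canonical (suc zero) {ℓ = suc (suc ℓ)} M≤N P≢Q run start end (s≤s ())
short-transfers-canonical (suc (suc m)) =
  short-transfers-canonical-step (short-transfers-canonical (suc m)) (short-transfers-canonical m)

canonical : ℕ → Peg → Peg → ℕ → Config
canonical zero          P Q i       d = P
canonical (suc zero)    P Q zero    d = P
canonical (suc zero)    P Q (suc i) d = Q
canonical (suc (suc m)) P Q i       d =
  if does (i ≤? optimalLength (suc m))
  then (if does (d ≤? suc m) then canonical (suc m) P (third P Q) i d else P)
  else (if does (d ≤? m) then canonical m (third P Q) Q (i ∸ suc (optimalLength (suc m))) d else Q)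

module _ (m : ℕ) (P Q : Peg) {i d : ℕ} where

  canonical-early-small : i ≤ optimalLength (suc m) → d ≤ suc m →
    canonical (suc (suc m)) P Q i d ≡ canonical (suc m) P (third P Q) i d
  canonical-early-small i≤ d≤
    rewrite dec-true (i ≤? optimalLength (suc m)) i≤ | dec-true (d ≤? suc m) d≤ = refl

  canonical-early-large : i ≤ optimalLength (suc m) → suc m < d → canonical (suc (suc m)) P Q i d ≡ P
  canonical-early-large i≤ d>
    rewrite dec-true (i ≤? optimalLength (suc m)) i≤ | dec-false (d ≤? suc m) (<⇒≱ d>) = refl

  canonical-late-small : optimalLength (suc m) < i → d ≤ m →
    canonical (suc (suc m)) P Q i d ≡ canonical m (third P Q) Q (i ∸ suc (optimalLength (suc m))) d
  canonical-late-small i> d≤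
    rewrite dec-false (i ≤? optimalLength (suc m)) (<⇒≱ i>) | dec-true (d ≤? m) d≤ = refl

  canonical-late-large : optimalLength (suc m) < i → m < d → canonical (suc (suc m)) P Q i d ≡ Q
  canonical-late-large i> d>
    rewrite dec-false (i ≤? optimalLength (suc m)) (<⇒≱ i>) | dec-false (d ≤? m) (<⇒≱ d>) = refl

canonical-start : ∀ m P Q d → canonical m P Q 0 d ≡ P
canonical-start zero          P Q d = refl
canonical-start (suc zero)    P Q d = refl
canonical-start (suc (suc m)) P Q d =
  [ (λ d≤ → trans (canonical-early-small m P Q z≤n d≤) (canonical-start (suc m) P (third P Q) d))
  , canonical-early-large m P Q z≤n
  ]′ (≤-<-connex d (suc m))

canonical-end : ∀ m P Q → Tower m (canonical m P Q (optimalLength m)) Q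
canonical-end zero          P Q (suc d) 1≤d ()
canonical-end (suc zero)    P Q d 1≤d d≤1 = refl
canonical-end (suc (suc m)) P Q d 1≤d d≤ with d ≤? m
... | yes d≤m = begin
  canonical (suc (suc m)) P Q (optimalLength (suc (suc m))) d
    ≡⟨ canonical-late-small m P Q (optimalLength-suc<suc-suc m) d≤m ⟩
  canonical m (third P Q) Q (optimalLength (suc (suc m)) ∸ suc (optimalLength (suc m))) d
    ≡⟨ cong (λ i → canonical m (third P Q) Q i d) (optimalLength-suc-suc-∸ m) ⟩
  canonical m (third P Q) Q (optimalLength m) d
    ≡⟨ canonical-end m (third P Q) Q d 1≤d d≤m ⟩
  Q ∎
  where open ≡-Reasoning
... | no d≰m = canonical-late-large m P Q (optimalLength-suc<suc-suc m) (≰⇒> d≰m)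

Move-extend : ∀ {s t s′ t′} → Move m k s t → m ≤ N →
  (∀ d → 1 ≤ d → d ≤ m → s′ d ≡ s d) → (∀ d → 1 ≤ d → d ≤ m → t′ d ≡ t d) →
  (∀ d → m < d → d ≤ N → t′ d ≡ s′ d) → Move N k s′ t′
Move-extend {m} {k} {N} {s} {t} {s′} {t′} move m≤N same-s same-t fixed = record
  { 1≤k = 1≤k ; k≤N = ≤-trans k≤N m≤N ; X = X ; Y = Y ; Z = Z ; X≢Y = X≢Y ; Y≢Z = Y≢Z ; X≢Z = X≢Z
  ; source = trans (same-s k 1≤k k≤N) source
  ; spare  = λ d 1≤d d<k → trans (same-s d 1≤d (≤-trans (<⇒≤ d<k) k≤N)) (spare d 1≤d d<k)
  ; target = trans (same-t k 1≤k k≤N) target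
  ; target-pred = λ 2≤k → trans (same-t (k ∸ 1) (∸-monoˡ-≤ 1 2≤k) (≤-trans (m∸n≤m k 1) k≤N)) (target-pred 2≤k)
  ; frame  = frame′ }
  where
  open Move move
  frame′ : ∀ d → 1 ≤ d → d ≤ N → d ≢ k → d ≢ k ∸ 1 → t′ d ≡ s′ d
  frame′ d 1≤d d≤N d≢k d≢k-1 with d ≤? m
  ... | yes d≤m = trans (same-t d 1≤d d≤m) (trans (frame d 1≤d d≤m d≢k d≢k-1) (sym (same-s d 1≤d d≤m)))
  ... | no d≰m  = fixed d (≰⇒> d≰m) d≤N

canonical-top-move : ∀ m {P Q} → P ≢ Q →
  Move (suc (suc m)) (suc (suc m)) (canonical (suc (suc m)) P Q (optimalLength (suc m)))
                                   (canonical (suc (suc m)) P Q (suc (optimalLength (suc m))))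
canonical-top-move m {P} {Q} P≢Q = record
  { 1≤k = s≤s z≤n ; k≤N = ≤-refl ; X = P ; Y = third P Q ; Z = Q
  ; X≢Y = λ e → third-≢ˡ P≢Q (sym e) ; Y≢Z = third-≢ʳ P≢Q ; X≢Z = P≢Q
  ; source = canonical-early-large m P Q ≤-refl ≤-refl
  ; spare  = λ d 1≤d d<k → before d 1≤d (s≤s⁻¹ d<k)
  ; target = canonical-late-large m P Q ≤-refl (n≤1+n _)
  ; target-pred = λ _ → canonical-late-large m P Q ≤-refl ≤-refl
  ; frame  = λ d 1≤d d≤N d≢k d≢k-1 → trans (after d 1≤d (below d≤N d≢k d≢k-1))
                                            (sym (before d 1≤d (m≤n⇒m≤1+n (below d≤N d≢k d≢k-1)))) }
  where
  before : Tower (suc m) (canonical (suc (suc m)) P Q (optimalLength (suc m))) (third P Q)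
  before d 1≤d d≤ = trans (canonical-early-small m P Q ≤-refl d≤) (canonical-end (suc m) P (third P Q) d 1≤d d≤)
  after : Tower m (canonical (suc (suc m)) P Q (suc (optimalLength (suc m)))) (third P Q)
  after d 1≤d d≤ = begin
    canonical (suc (suc m)) P Q (suc (optimalLength (suc m))) d
      ≡⟨ canonical-late-small m P Q ≤-refl d≤ ⟩
    canonical m (third P Q) Q (suc (optimalLength (suc m)) ∸ suc (optimalLength (suc m))) d
      ≡⟨ cong (λ i → canonical m (third P Q) Q i d) (n∸n≡0 (suc (optimalLength (suc m)))) ⟩
    canonical m (third P Q) Q 0 d
      ≡⟨ canonical-start m (third P Q) Q d ⟩
    third P Q ∎
    where open ≡-Reasoning
  below : ∀ {d} → d ≤ suc (suc m) → d ≢ suc (suc m) → d ≢ suc m → d ≤ m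
  below d≤ d≢ d≢′ = s≤s⁻¹ (≤∧≢⇒< (s≤s⁻¹ (≤∧≢⇒< d≤ d≢)) d≢′)

CanonicalSteps : ℕ → Set
CanonicalSteps m = ∀ {P Q} → P ≢ Q → ∀ {i} → i < optimalLength m →
  Move m (label m i) (canonical m P Q i) (canonical m P Q (suc i))

canonical-step-one : CanonicalSteps 1
canonical-step-one {P} {Q} P≢Q {zero} _ = record
  { 1≤k = ≤-refl ; k≤N = ≤-refl ; X = P ; Y = third P Q ; Z = Q
  ; X≢Y = λ e → third-≢ˡ P≢Q (sym e) ; Y≢Z = third-≢ʳ P≢Q ; X≢Z = P≢Q
  ; source = refl ; spare = λ { d 1≤d (s≤s d≤0) → contradiction (≤-trans 1≤d d≤0) λ () }
  ; target = refl ; target-pred = λ { (s≤s ()) }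
  ; frame = λ d 1≤d d≤1 d≢1 _ → contradiction (≤-antisym d≤1 1≤d) d≢1 }
canonical-step-one P≢Q {suc i} (s≤s ())

canonical-step-suc-suc : CanonicalSteps (suc m) → CanonicalSteps m → CanonicalSteps (suc (suc m))
canonical-step-suc-suc {m} steps₁ steps₀ {P} {Q} P≢Q {i} i< with <-cmp i (optimalLength (suc m))
... | tri< i<a _ _ = Move-relabel (label-early m i<a)
  (Move-extend (steps₁ (λ e → third-≢ˡ P≢Q (sym e)) i<a) (n≤1+n _)
          (λ d _ d≤ → canonical-early-small m P Q (<⇒≤ i<a) d≤)
          (λ d _ d≤ → canonical-early-small m P Q i<a d≤)
          (λ d d> _ → trans (canonical-early-large m P Q i<a d>) (sym (canonical-early-large m P Q (<⇒≤ i<a) d>))))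
... | tri≈ _ refl _ = Move-relabel (label-middle m refl) (canonical-top-move m P≢Q)
... | tri> _ _ a<i = Move-relabel (label-late m a<i)
  (Move-extend (subst (λ j → Move m (label m i′) (canonical m Y Q i′) (canonical m Y Q j)) (sym shift)
                            (steps₀ (third-≢ʳ P≢Q) i′<))
          (≤-trans (n≤1+n m) (n≤1+n (suc m)))
          (λ d _ d≤ → canonical-late-small m P Q a<i d≤)
          (λ d _ d≤ → canonical-late-small m P Q (m≤n⇒m≤1+n a<i) d≤)
          (λ d d> _ → trans (canonical-late-large m P Q (m≤n⇒m≤1+n a<i) d>)
                            (sym (canonical-late-large m P Q a<i d>))))
  where
  Y : Peg
  Y = third P Q
  i′ : ℕ
  i′ = i ∸ suc (optimalLength (suc m))
  shift : suc i ∸ suc (optimalLength (suc m)) ≡ suc i′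
  shift = +-∸-assoc 1 a<i
  i′< : i′ < optimalLength m
  i′< = ≤-trans (∸-monoˡ-< i< a<i) (≤-reflexive (optimalLength-suc-suc-∸ m))

canonical-step : ∀ m → CanonicalSteps m
canonical-step zero          P≢Q ()
canonical-step (suc zero)    = canonical-step-one
canonical-step (suc (suc m)) = canonical-step-suc-suc (canonical-step (suc m)) (canonical-step m)

private variable
  x : ℕ
  u v : ℕ → Bool

true≢false : true ≢ false
true≢false ()

zero-before-one : (∀ l → u l ≡ true → u (suc l) ≡ false) → ∀ {l} → u (suc l) ≡ true → u l ≡ false
zero-before-one sparse {l} one = ¬-not λ e → true≢false (trans (sym one) (sparse l e))

fibSum-zero : ∀ u → fibSum u zero ≡ 0
fibSum-zero u with u zero
... | true  = refl
... | false = refl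

fibSum-true : ∀ u N → u (suc N) ≡ true → fibSum u (suc N) ≡ fibSum u N + fib (suc N)
fibSum-true u N e rewrite e = refl

fibSum-false : ∀ u N → u (suc N) ≡ false → fibSum u (suc N) ≡ fibSum u N
fibSum-false u N e rewrite e = +-identityʳ (fibSum u N)

fibSum-ext : ∀ u v N → (∀ l → l ≤ N → u l ≡ v l) → fibSum u N ≡ fibSum v N
fibSum-ext u v zero    same = trans (fibSum-zero u) (sym (fibSum-zero v))
fibSum-ext u v (suc N) same =
  cong₂ _+_ (fibSum-ext u v N (λ l l≤N → same l (m≤n⇒m≤1+n l≤N)))
            (cong (λ b → if b then fib (suc N) else 0) (same (suc N) ≤-refl))

fibSum<fib : ∀ u N → (∀ l → u l ≡ true → 2 ≤ l) → (∀ l → u l ≡ true → u (suc l) ≡ false) →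
  fibSum u N < fib (suc N)
fibSum<fib u zero          from-2 sparse = ≤-reflexive (cong suc (fibSum-zero u))
fibSum<fib u (suc zero)    from-2 sparse =
  ≤-reflexive (cong suc (trans (fibSum-false u 0 (¬-not λ u1 → contradiction (from-2 1 u1) λ { (s≤s ()) })) (fibSum-zero u)))
fibSum<fib u (suc (suc N)) from-2 sparse =
  by-top-digit (fibSum<fib u N from-2 sparse) (fibSum<fib u (suc N) from-2 sparse) (u (suc (suc N)) Data.Bool.≟ true)
  where
  open ≤-Reasoning
  by-top-digit : fibSum u N < fib (suc N) → fibSum u (suc N) < fib (suc (suc N)) → Dec (u (suc (suc N)) ≡ true) →
    fibSum u (suc (suc N)) < fib (suc (suc (suc N)))
  by-top-digit below₀ below₁ (yes e) = begin-strict
    fibSum u (suc (suc N))                ≡⟨ fibSum-true u (suc N) e ⟩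
    fibSum u (suc N) + fib (suc (suc N))
      ≡⟨ cong (_+ fib (suc (suc N))) (fibSum-false u N (zero-before-one sparse e)) ⟩
    fibSum u N + fib (suc (suc N))        <⟨ +-monoˡ-< (fib (suc (suc N))) below₀ ⟩
    fib (suc N) + fib (suc (suc N))       ≡⟨ +-comm (fib (suc N)) (fib (suc (suc N))) ⟩
    fib (suc (suc (suc N)))               ∎
  by-top-digit below₀ below₁ (no e) = begin-strict
    fibSum u (suc (suc N))  ≡⟨ fibSum-false u (suc N) (¬-not e) ⟩
    fibSum u (suc N)        <⟨ below₁ ⟩
    fib (suc (suc N))       ≤⟨ m≤m+n _ _ ⟩
    fib (suc (suc (suc N))) ∎

zeckendorf-bound : IsZeckendorf m x u → x < fib (suc (suc m))
zeckendorf-bound {m} {x} {u} (support , sparse , x≡) =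
  subst (_< fib (suc (suc m))) (sym x≡) (fibSum<fib u (suc m) (λ l e → proj₁ (support l e)) sparse)

zeckendorf-above : IsZeckendorf m x u → ∀ l → suc m < l → u l ≡ false
zeckendorf-above (support , _) l m<l = ¬-not λ e → <⇒≱ m<l (proj₂ (support l e))

zeckendorf-lower : IsZeckendorf (suc m) x u → u (suc (suc m)) ≡ false → IsZeckendorf m x u
zeckendorf-lower {m} {x} {u} (support , sparse , x≡) top = support′ , sparse , trans x≡ (fibSum-false u (suc m) top)
  where
  support′ : ∀ l → u l ≡ true → 2 ≤ l × l ≤ suc m
  support′ l e with m≤n⇒m<n∨m≡n (proj₂ (support l e))
  ... | inj₁ (s≤s l≤) = proj₁ (support l e) , l≤
  ... | inj₂ refl     = contradiction (trans (sym e) top) true≢false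

zeckendorf-top-false : IsZeckendorf (suc m) x u → x < fib (suc (suc m)) → u (suc (suc m)) ≡ false
zeckendorf-top-false {m} {x} {u} (_ , _ , x≡) x< = ¬-not λ top → <⇒≱ x< (begin
  fib (suc (suc m))                       ≤⟨ m≤n+m (fib (suc (suc m))) (fibSum u (suc m)) ⟩
  fibSum u (suc m) + fib (suc (suc m))    ≡⟨ fibSum-true u (suc m) top ⟨
  fibSum u (suc (suc m))                  ≡⟨ x≡ ⟨
  x                                       ∎)
  where open ≤-Reasoning

zeckendorf-top-true : IsZeckendorf (suc m) x u → fib (suc (suc m)) ≤ x → u (suc (suc m)) ≡ true
zeckendorf-top-true {m} {u = u} z F≤x with u (suc (suc m)) Data.Bool.≟ true
... | yes top = top
... | no ¬top = contradiction (zeckendorf-bound (zeckendorf-lower z (¬-not ¬top))) (≤⇒≯ F≤x)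

truncate : ℕ → (ℕ → Bool) → ℕ → Bool
truncate M u l = if does (l ≤? M) then u l else false

module _ {M l : ℕ} (u : ℕ → Bool) where

  truncate-≤ : l ≤ M → truncate M u l ≡ u l
  truncate-≤ l≤M rewrite dec-true (l ≤? M) l≤M = refl

  truncate-> : M < l → truncate M u l ≡ false
  truncate-> M<l rewrite dec-false (l ≤? M) (<⇒≱ M<l) = refl

  truncate-true : truncate M u l ≡ true → l ≤ M × u l ≡ true
  truncate-true e with ≤-<-connex l M
  ... | inj₁ l≤M = l≤M , trans (sym (truncate-≤ l≤M)) e
  ... | inj₂ M<l = contradiction (trans (sym e) (truncate-> M<l)) true≢false

zeckendorf-remove-top : IsZeckendorf (suc (suc m)) x u → u (suc (suc (suc m))) ≡ true →
  IsZeckendorf m (x ∸ fib (suc (suc (suc m)))) (truncate (suc m) u)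
zeckendorf-remove-top {m} {x} {u} (support , sparse , x≡) top = support′ , sparse′ , sum′
  where
  F : ℕ
  F = fib (suc (suc (suc m)))
  support′ : ∀ l → truncate (suc m) u l ≡ true → 2 ≤ l × l ≤ suc m
  support′ l e = proj₁ (support l (proj₂ (truncate-true u e))) , proj₁ (truncate-true u e)
  sparse′ : ∀ l → truncate (suc m) u l ≡ true → truncate (suc m) u (suc l) ≡ false
  sparse′ l e with suc l ≤? suc m
  ... | yes l<  = trans (truncate-≤ u l<) (sparse l (proj₂ (truncate-true u e)))
  ... | no  l≮ = truncate-> u (≰⇒> l≮)
  sum′ : x ∸ F ≡ fibSum (truncate (suc m) u) (suc m)
  sum′ = begin
    x ∸ F                             ≡⟨ cong (_∸ F) x≡ ⟩
    fibSum u (suc (suc (suc m))) ∸ F  ≡⟨ cong (_∸ F) (fibSum-true u (suc (suc m)) top) ⟩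
    (fibSum u (suc (suc m)) + F) ∸ F  ≡⟨ cong (λ y → (y + F) ∸ F) (fibSum-false u (suc m) (zero-before-one sparse top)) ⟩
    (fibSum u (suc m) + F) ∸ F        ≡⟨ m+n∸n≡m (fibSum u (suc m)) F ⟩
    fibSum u (suc m)                  ≡⟨ fibSum-ext u (truncate (suc m) u) (suc m) (λ l l≤ → sym (truncate-≤ u l≤)) ⟩
    fibSum (truncate (suc m) u) (suc m) ∎
    where open ≡-Reasoning

highest-difference-unique : ∀ {j M} → u M ≢ v M → u j ≢ v j →
  (∀ l → j < l → u l ≡ v l) → (∀ l → M < l → u l ≡ v l) → j ≡ M
highest-difference-unique {j = j} {M} uM≢vM uj≢vj above-j above-M with <-cmp j M
... | tri< j<M _ _ = contradiction (above-j M j<M) uM≢vM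
... | tri≈ _ j≡M _ = j≡M
... | tri> _ _ M<j = contradiction (above-M j M<j) uj≢vj

LabelIsHighestChange : ℕ → Set
LabelIsHighestChange n = ∀ {i u v j} → suc i < fib (suc (suc n)) →
  IsZeckendorf n i u → IsZeckendorf n (suc i) v → u j ≢ v j → (∀ l → j < l → u l ≡ v l) → label n i ≡ j ∸ 1

label-is-highest-change-one : LabelIsHighestChange 1
label-is-highest-change-one {zero} {u} {v} {j} _ zu zv uj≢vj above-j =
  cong (_∸ 1) (sym (highest-difference-unique u2≢v2 uj≢vj above-j above-2))
  where
  u2≢v2 : u 2 ≢ v 2
  u2≢v2 e = true≢false (trans (sym (zeckendorf-top-true zv ≤-refl))
                              (trans (sym e) (zeckendorf-top-false zu ≤-refl)))
  above-2 : ∀ l → 2 < l → u l ≡ v l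
  above-2 l 2<l = trans (zeckendorf-above zu l 2<l) (sym (zeckendorf-above zv l 2<l))
label-is-highest-change-one {suc i} (s≤s (s≤s ()))

-- Above m+1 the expansions agree: both have digit 1 at m+3, hence 0 at m+2, and 0 beyond m+3.
difference-below-top : ∀ {y j} → IsZeckendorf (suc (suc m)) x u → IsZeckendorf (suc (suc m)) y v →
  u (suc (suc (suc m))) ≡ true → v (suc (suc (suc m))) ≡ true → u j ≢ v j → j ≤ suc m
difference-below-top {m} {j = j} zu zv u-top v-top uj≢vj with ≤-<-connex j (suc m)
... | inj₁ j≤ = j≤
... | inj₂ m<j with m≤n⇒m<n∨m≡n m<j
...   | inj₂ refl = contradiction (trans (zero-before-one (proj₁ (proj₂ zu)) u-top)
                                          (sym (zero-before-one (proj₁ (proj₂ zv)) v-top))) uj≢vj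
...   | inj₁ m+1<j with m≤n⇒m<n∨m≡n m+1<j
...     | inj₂ refl   = contradiction (trans u-top (sym v-top)) uj≢vj
...     | inj₁ m+2<j = contradiction (trans (zeckendorf-above zu j m+2<j) (sym (zeckendorf-above zv j m+2<j))) uj≢vj

label-is-highest-change-step :
  LabelIsHighestChange (suc m) → LabelIsHighestChange m → LabelIsHighestChange (suc (suc m))
label-is-highest-change-step {m} lower₁ lower₀ {i} {u} {v} {j} i<F zu zv uj≢vj above-j
  with <-cmp i (optimalLength (suc m))
... | tri< i<a _ _ = trans (label-early m i<a)
  (lower₁ si<F (zeckendorf-lower zu (zeckendorf-top-false zu (≤-trans (n≤1+n _) si<F)))
               (zeckendorf-lower zv (zeckendorf-top-false zv si<F)) uj≢vj above-j)
  where
  si<F : suc i < fib (suc (suc (suc m)))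
  si<F = ≤-trans (s≤s i<a) (≤-reflexive (suc-optimalLength (suc m)))
... | tri≈ _ refl _ = trans (label-middle m refl)
  (cong (_∸ 1) (sym (highest-difference-unique top-differs uj≢vj above-j above-top)))
  where
  top-differs : u (suc (suc (suc m))) ≢ v (suc (suc (suc m)))
  top-differs e = true≢false (trans (sym (zeckendorf-top-true zv (≤-reflexive (sym (suc-optimalLength (suc m))))))
                                    (trans (sym e) (zeckendorf-top-false zu (≤-reflexive (suc-optimalLength (suc m))))))
  above-top : ∀ l → suc (suc (suc m)) < l → u l ≡ v l
  above-top l top<l = trans (zeckendorf-above zu l top<l) (sym (zeckendorf-above zv l top<l))
... | tri> _ _ a<i = trans (label-late m a<i) (trans (cong (label m) shift)
  (lower₀ si′<F (zeckendorf-remove-top zu u-top)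
          (subst (λ y → IsZeckendorf m y (truncate (suc m) v)) (+-∸-assoc 1 F≤i) (zeckendorf-remove-top zv v-top))
          (λ e → uj≢vj (trans (sym (truncate-≤ u j≤)) (trans e (truncate-≤ v j≤))))
          above-j′))
  where
  F : ℕ
  F = fib (suc (suc (suc m)))
  F≤i : F ≤ i
  F≤i = ≤-trans (≤-reflexive (sym (suc-optimalLength (suc m)))) a<i
  shift : i ∸ suc (optimalLength (suc m)) ≡ i ∸ F
  shift = cong (i ∸_) (suc-optimalLength (suc m))
  u-top : u (suc (suc (suc m))) ≡ true
  u-top = zeckendorf-top-true zu F≤i
  v-top : v (suc (suc (suc m))) ≡ true
  v-top = zeckendorf-top-true zv (m≤n⇒m≤1+n F≤i)
  j≤ : j ≤ suc m
  j≤ = difference-below-top zu zv u-top v-top uj≢vj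
  si′<F : suc (i ∸ F) < fib (suc (suc m))
  si′<F = subst (_< fib (suc (suc m))) (+-∸-assoc 1 F≤i)
            (≤-trans (∸-monoˡ-< i<F (m≤n⇒m≤1+n F≤i)) (≤-reflexive (m+n∸m≡n F (fib (suc (suc m))))))
  above-j′ : ∀ l → j < l → truncate (suc m) u l ≡ truncate (suc m) v l
  above-j′ l j<l with ≤-<-connex l (suc m)
  ... | inj₁ l≤ = trans (truncate-≤ u l≤) (trans (above-j l j<l) (sym (truncate-≤ v l≤)))
  ... | inj₂ l> = trans (truncate-> u l>) (sym (truncate-> v l>))

label-is-highest-change : ∀ n → LabelIsHighestChange n
label-is-highest-change zero          (s≤s ()) _ _ _ _
label-is-highest-change (suc zero)    = label-is-highest-change-one
label-is-highest-change (suc (suc m)) =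
  label-is-highest-change-step (label-is-highest-change (suc m)) (label-is-highest-change m)

toConfig : ∀ {n} → State n → Config
toConfig         s zero    = pegA
toConfig {n = n} s (suc d) with d <? n
... | yes d<n = s (fromℕ< d<n)
... | no  _   = pegA

toConfig-disk : ∀ {n} (s : State n) (i : Fin n) → toConfig s (disk i) ≡ s i
toConfig-disk {n} s i with toℕ i <? n
... | yes i<n = cong s (fromℕ<-toℕ i i<n)
... | no  i≮n = contradiction (toℕ<n i) i≮n

disk-onto : ∀ {n d} → 1 ≤ d → d ≤ n → Σ (Fin n) λ i → disk i ≡ d
disk-onto {d = suc d} _ d<n = fromℕ< d<n , cong suc (toℕ-fromℕ< d<n)

toConfig-at : ∀ {n} (c : State n) {d} → 1 ≤ d → d ≤ n → (∀ i → disk i ≡ d → c i ≡ P) → toConfig c d ≡ P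
toConfig-at c 1≤d d≤n at-d with disk-onto 1≤d d≤n
... | i , refl = trans (toConfig-disk c i) (at-d i refl)

toConfig-tower : ∀ {n} {c : State n} → (∀ i → c i ≡ P) → Tower n (toConfig c) P
toConfig-tower {c = c} all-P d 1≤d d≤n = toConfig-at c 1≤d d≤n λ i _ → all-P i

FibMove⇒Move : ∀ {n} {s t : State n} → FibMove n k s t → Move n k (toConfig s) (toConfig t)
FibMove⇒Move {k} {n} {s} {t} (1≤k , k≤n , X , Y , Z , X≢Y , Y≢Z , X≢Z , on-X , on-Y , on-Z , unchanged) =
  record
  { 1≤k = 1≤k ; k≤N = k≤n ; X = X ; Y = Y ; Z = Z ; X≢Y = X≢Y ; Y≢Z = Y≢Z ; X≢Z = X≢Z
  ; source = toConfig-at s 1≤k k≤n on-X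
  ; spare  = λ d 1≤d d<k → toConfig-at s 1≤d (≤-trans (<⇒≤ d<k) k≤n) λ i e → on-Y i (subst (_< k) (sym e) d<k)
  ; target = toConfig-at t 1≤k k≤n λ i e → on-Z i (inj₁ e)
  ; target-pred = λ 2≤k → toConfig-at t (∸-monoˡ-≤ 1 2≤k) (≤-trans (m∸n≤m k 1) k≤n) λ i e → on-Z i (inj₂ e)
  ; frame  = λ d 1≤d d≤n d≢k d≢k-1 → toConfig-at t 1≤d d≤n λ i e →
      trans (unchanged i (λ e′ → d≢k (trans (sym e) e′)) (λ e′ → d≢k-1 (trans (sym e) e′)))
            (trans (sym (toConfig-disk s i)) (cong (toConfig s) e)) }

Move⇒FibMove : ∀ {n} {s t : Config} → Move n k s t → FibMove n k (λ i → s (disk i)) (λ i → t (disk i))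
Move⇒FibMove {k} {n} {s} {t} move =
  1≤k , k≤N , X , Y , Z , X≢Y , Y≢Z , X≢Z ,
  (λ i e → trans (cong s e) source) , (λ i d<k → spare (disk i) (s≤s z≤n) d<k) , on-Z ,
  (λ i d≢k d≢k-1 → frame (disk i) (s≤s z≤n) (toℕ<n i) d≢k d≢k-1)
  where
  open Move move
  on-Z : ∀ i → disk i ≡ k ⊎ disk i ≡ k ∸ 1 → t (disk i) ≡ Z
  on-Z i (inj₁ e) = trans (cong t e) target
  on-Z i (inj₂ e) = trans (cong t e) (target-pred (2≤k e))
    where
    2≤k : ∀ {d} → suc d ≡ k ∸ 1 → 2 ≤ k
    2≤k {d} e = ≤-trans (s≤s (s≤s z≤n)) (≤-trans (s≤s (≤-reflexive e)) (≤-reflexive (m+[n∸m]≡n 1≤k)))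

canonical-solution : ∀ n → IsSolution n (optimalLength n) (λ i f → canonical n pegA pegC i (disk f))
canonical-solution n =
  (λ f → canonical-start n pegA pegC (disk f)) ,
  (λ f → canonical-end n pegA pegC (disk f) (s≤s z≤n) (toℕ<n f)) ,
  (λ i i< → label n i , Move⇒FibMove (canonical-step n (λ ()) i<))

solution-run : ∀ {n L} {s : ℕ → State n} → (∀ i → i < L → Step n (s i) (s (suc i))) →
  Σ (ℕ → ℕ) λ lab → Run n n (λ i → toConfig (s i)) lab L
solution-run {n} {L} {s} steps = moved , record { label≤ = λ i i<L → Move.k≤N (move i i<L) ; step = move }
  where
  moved : ℕ → ℕ
  moved i with i <? L
  ... | yes i<L = proj₁ (steps i i<L)
  ... | no  _   = 0
  move : ∀ i → i < L → Move n (moved i) (toConfig (s i)) (toConfig (s (suc i)))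
  move i i<L with i <? L
  ... | yes i<L′ = FibMove⇒Move (proj₂ (steps i i<L′))
  ... | no  i≮L  = contradiction i<L i≮L

optimal-solution-canonical : ∀ {n L} {s : ℕ → State n} → IsOptimalSolution n L s →
  L ≡ optimalLength n × (∀ {i k} → i < L → FibMove n k (s i) (s (suc i)) → k ≡ label n i)
optimal-solution-canonical {n} {L} {s} ((start , end , steps) , optimal) = proj₁ canonical-run , canonical-move
  where
  moved : ℕ → ℕ
  moved = proj₁ (solution-run steps)
  run : Run n n (λ i → toConfig (s i)) moved L
  run = proj₂ (solution-run steps)
  canonical-run : L ≡ optimalLength n × (∀ i → i < L → moved i ≡ label n i)
  canonical-run = short-transfers-canonical n ≤-refl (λ ()) run (toConfig-tower start) (toConfig-tower end)
                                            (optimal _ _ (canonical-solution n))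
  canonical-move : ∀ {i k} → i < L → FibMove n k (s i) (s (suc i)) → k ≡ label n i
  canonical-move {i} i<L move =
    trans (Move-label-unique (FibMove⇒Move move) (Run.step run i i<L)) (proj₂ canonical-run i i<L)

theorem2p3 : (n k : ℕ) → 0 < k → k < fib (suc (suc n)) →
    (u v : ℕ → Bool) → IsZeckendorf n (k ∸ 1) u → IsZeckendorf n k v →
    (j : ℕ) → u j ≢ v j → (∀ i → j < i → u i ≡ v i) →
    (L : ℕ) (s : ℕ → State n) → IsOptimalSolution n L s →
    k ≤ L × FibMove n (j ∸ 1) (s (k ∸ 1)) (s k)
theorem2p3 n k 0<k k<F u v zu zv j uj≢vj above-j L s optimal =
  k≤L , subst₂ (λ k′ t → FibMove n k′ (s (k ∸ 1)) (s t)) moved≡ k≡ (proj₂ move)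
  where
  k≡ : suc (k ∸ 1) ≡ k
  k≡ = m+[n∸m]≡n 0<k
  k≤L : k ≤ L
  k≤L = ≤-trans (s≤s⁻¹ (≤-trans k<F (≤-reflexive (sym (suc-optimalLength n)))))
                (≤-reflexive (sym (proj₁ (optimal-solution-canonical optimal))))
  k-1<L : k ∸ 1 < L
  k-1<L = ≤-trans (≤-reflexive k≡) k≤L
  move : Step n (s (k ∸ 1)) (s (suc (k ∸ 1)))
  move = proj₂ (proj₂ (proj₁ optimal)) (k ∸ 1) k-1<L
  moved≡ : proj₁ move ≡ j ∸ 1
  moved≡ = begin
    proj₁ move       ≡⟨ proj₂ (optimal-solution-canonical optimal) k-1<L (proj₂ move) ⟩
    label n (k ∸ 1)  ≡⟨ label-is-highest-change n (subst (_< fib (suc (suc n))) (sym k≡) k<F)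
                          zu (subst (λ x → IsZeckendorf n x v) (sym k≡) zv) uj≢vj above-j ⟩
    j ∸ 1            ∎
    where open ≡-Reasoning
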